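{- Let $\ell, s \geqslant 0$ be integers, $G$ a graph, and $L$ an $s$-link of $\mathbb{L}_\ell(G)$. Then $L$ is an $s$-link of the partitioned graph $\widetilde{\mathbb{L}}_\ell(G)$ if and only if there exists an $(\ell + s)$-link $R$ of $G$ such that $L = R^{[\ell]}$.
   Context: All graphs are undirected and loopless; they may contain parallel edges and may be infinite. For $\ell \geqslant 0$, an $\ell$-link of a graph is a walk $[v_0, e_1, v_1, \ldots, e_\ell, v_\ell]$ of length $\ell$ in which consecutive edges are different, identified with its reverse. The $\ell$-link graph $\mathbb{L}_\ell(G)$ has as vertices the $\ell$-links of $G$, and each $(\ell+1)$-link $Q = [v_0, e_1, \ldots, e_{\ell+1}, v_{\ell+1}]$ of $G$ is an edge joining $[v_0, \ldots, e_\ell, v_\ell]$ and $[v_1, \ldots, e_{\ell+1}, v_{\ell+1}]$. The edge partition $\mathcal{E}_\ell(G)$ of $E(\mathbb{L}_\ell(G))$: for $\ell = 0$ every part is a single edge; for $\ell \geqslant 1$ two edges $Q, Q'$ are in the same part iff their middle $(\ell-1)$-links $[v_1, e_2, \ldots, e_\ell, v_\ell]$ coincide. $\widetilde{\mathbb{L}}_\ell(G)$ denotes $\mathbb{L}_\ell(G)$ together with this edge partition (and a vertex partition not needed here). An $s$-link of $\widetilde{\mathbb{L}}_\ell(G)$ is an $s$-link of $\mathbb{L}_\ell(G)$ whose consecutive edges lie in different parts of $\mathcal{E}_\ell(G)$. For an $(\ell+s)$-link $R = [v_0, e_1, \ldots, e_{\ell+s}, v_{\ell+s}]$ of $G$,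 put $L_i := [v_i, e_{i+1}, \ldots, e_{i+\ell}, v_{i+\ell}]$ ($0 \leqslant i \leqslant s$) and $Q_j := [v_{j-1}, e_j, \ldots, e_{j+\ell}, v_{j+\ell}]$ ($1 \leqslant j \leqslant s$); then $R^{[\ell]} := [L_0, Q_1, L_1, \ldots, Q_s, L_s]$, an $s$-link of $\mathbb{L}_\ell(G)$. -}

module Defs where

open import Data.Nat using (ℕ; zero; suc; _+_; _≤_; z≤n; s≤s)
open import Data.Nat.Properties using (m≤n+m; n≤1+n; ≤-trans; +-comm)
open import Data.Product using (Σ; _×_; _,_; proj₁; proj₂)
open import Data.Sum using (_⊎_)
open import Data.Unit using (⊤)
open import Relation.Nullary using (¬_)
open import Relation.Binary.PropositionalEquality using (_≡_; _≢_; subst)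

-- Graphs: undirected, loopless, parallel edges allowed, possibly infinite.
-- An edge e has two (distinct) ends; it joins u and v iff its ends are
-- (u , v) in either order.

record Graph : Set₁ where
  field
    V        : Set
    E        : Set
    ends     : E → V × V
    loopless : ∀ e → proj₁ (ends e) ≢ proj₂ (ends e)

  Joins : E → V → V → Set
  Joins e u v = (ends e ≡ (u , v)) ⊎ (ends e ≡ (v , u))

-- Raw walks of length n: [v₀, e₁, v₁, …, eₙ, vₙ]

data Walk (V E : Set) : ℕ → Set where
  [_]    : V → Walk V E zero
  _∷⟨_⟩_ : ∀ {n} → V → E → Walk V E n → Walk V E (suc n)

infixr 5 _∷⟨_⟩_

module _ {V E : Set} where

  first : ∀ {n} → Walk V E n → V
  first [ v ] = v
  first (v ∷⟨ _ ⟩ _) = v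

  snoc : ∀ {n} → Walk V E n → E → V → Walk V E (suc n)
  snoc [ u ] e v = u ∷⟨ e ⟩ [ v ]
  snoc (u ∷⟨ f ⟩ w) e v = u ∷⟨ f ⟩ snoc w e v

  reverse : ∀ {n} → Walk V E n → Walk V E n
  reverse [ v ] = [ v ]
  reverse (v ∷⟨ e ⟩ w) = snoc (reverse w) e v

  tail : ∀ {n} → Walk V E (suc n) → Walk V E n
  tail (_ ∷⟨ _ ⟩ w) = w

  init : ∀ {n} → Walk V E (suc n) → Walk V E n
  init (v ∷⟨ e ⟩ [ _ ]) = [ v ]
  init (v ∷⟨ e ⟩ (u ∷⟨ f ⟩ w)) = v ∷⟨ e ⟩ init (u ∷⟨ f ⟩ w)

  middle : ∀ {n} → Walk V E (suc (suc n)) → Walk V E n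
  middle w = init (tail w)

  prefix : ∀ {k n} → k ≤ n → Walk V E n → Walk V E k
  prefix z≤n w = [ first w ]
  prefix (s≤s p) (v ∷⟨ e ⟩ w) = v ∷⟨ e ⟩ prefix p w

  IsWalkBy : (E → V → V → Set) → ∀ {n} → Walk V E n → Set
  IsWalkBy Inc [ _ ] = ⊤
  IsWalkBy Inc (v ∷⟨ e ⟩ w) = Inc e v (first w) × IsWalkBy Inc w

  Consec : (E → E → Set) → ∀ {n} → Walk V E n → Set
  Consec D [ _ ] = ⊤
  Consec D (v ∷⟨ e ⟩ [ _ ]) = ⊤
  Consec D (v ∷⟨ e ⟩ (u ∷⟨ f ⟩ w)) = D e f × Consec D (u ∷⟨ f ⟩ w)

  AllV : (V → Set) → ∀ {n} → Walk V E n → Set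
  AllV P [ v ] = P v
  AllV P (v ∷⟨ _ ⟩ w) = P v × AllV P w

  AllE : (E → Set) → ∀ {n} → Walk V E n → Set
  AllE P [ _ ] = ⊤
  AllE P (_ ∷⟨ e ⟩ w) = P e × AllE P w

Pointwise : ∀ {V V' E E' : Set} → (V → V' → Set) → (E → E' → Set) →
            ∀ {n} → Walk V E n → Walk V' E' n → Set
Pointwise RV RE [ v ] [ v' ] = RV v v'
Pointwise RV RE (v ∷⟨ e ⟩ w) (v' ∷⟨ e' ⟩ w') =
  RV v v' × RE e e' × Pointwise RV RE w w'

module _ (G : Graph) where
  open Graph G

  IsLink : (ℓ : ℕ) → Walk V E ℓ → Set
  IsLink ℓ w = IsWalkBy Joins w × Consec _≢_ w

  -- ℓ-links are identified with their reverses
  _≈L_ : ∀ {ℓ} → Walk V E ℓ → Walk V E ℓ → Set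
  w ≈L w' = (w ≡ w') ⊎ (w ≡ reverse w')

  -- Vertices of 𝕃ℓ(G): ℓ-links (representatives); edges: (ℓ+1)-links.
  LVert : ℕ → Set
  LVert ℓ = Walk V E ℓ

  LEdge : ℕ → Set
  LEdge ℓ = Walk V E (suc ℓ)

  LJoins : ∀ {ℓ} → LEdge ℓ → LVert ℓ → LVert ℓ → Set
  LJoins Q A B = (init Q ≈L A × tail Q ≈L B) ⊎ (init Q ≈L B × tail Q ≈L A)

  LWalk : ℕ → ℕ → Set
  LWalk ℓ s = Walk (LVert ℓ) (LEdge ℓ) s

  IsLinkL : (ℓ s : ℕ) → LWalk ℓ s → Set
  IsLinkL ℓ s L =
    AllV (IsLink ℓ) L × AllE (IsLink (suc ℓ)) L ×
    IsWalkBy LJoins L × Consec (λ Q Q' → ¬ (Q ≈L Q')) L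

  SamePart : (ℓ : ℕ) → LEdge ℓ → LEdge ℓ → Set
  SamePart zero Q Q' = Q ≈L Q'
  SamePart (suc ℓ) Q Q' = middle Q ≈L middle Q'

  IsLinkLTilde : (ℓ s : ℕ) → LWalk ℓ s → Set
  IsLinkLTilde ℓ s L =
    IsLinkL ℓ s L × Consec (λ Q Q' → ¬ SamePart ℓ Q Q') L

  _≈LL_ : ∀ {ℓ s} → LWalk ℓ s → LWalk ℓ s → Set
  L ≈LL M = Pointwise _≈L_ _≈L_ L M ⊎ Pointwise _≈L_ _≈L_ L (reverse M)

  window : (ℓ s : ℕ) → Walk V E (s + ℓ) → LWalk ℓ s
  window ℓ zero R = [ R ]
  window ℓ (suc s) R =
    prefix (≤-trans (m≤n+m ℓ s) (n≤1+n (s + ℓ))) R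
      ∷⟨ prefix (s≤s (m≤n+m ℓ s)) R ⟩
    window ℓ s (tail R)

  linkL : (ℓ s : ℕ) → Walk V E (ℓ + s) → LWalk ℓ s
  linkL ℓ s R = window ℓ s (subst (Walk V E) (+-comm ℓ s) R)

-- Two facts about links
-- carry the geometry:
--   * an ℓ-link X of positive length never has init X ~ tail X (a link is
--     not a palindrome, because its middle would be one too);
--   * in a link, consecutive ℓ-windows Q_j, Q_{j+1} have different middles.
-- (⇐) The second fact says consecutive edges of R^[ℓ] lie in different parts
--     of ℰℓ(G); this transfers to anything ≈ R^[ℓ], also after reversal.
-- (⇒) By induction on s we build R from the back: the s-link L = A Q L'
--     of 𝕃̃ℓ(G) is oriented so that Q = [x, e, T] with T ~ B, the first
--     vertex of L'.  The partition condition forces T to be exactly the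
--     first ℓ-window of the link R' built for L', and the 𝕃ℓ(G)-link
--     condition forces x e R' to be non-backtracking.

module Submission where

open import Defs
open import Data.Nat using (ℕ; _+_)
open import Data.Product using (Σ; _×_)
open import Function.Bundles using (_⇔_)
open import Data.Nat using (zero; suc; _≤_; z≤n; s≤s)
open import Data.Nat.Properties using (≤-irrelevant; ≤-refl; +-comm)
open import Data.Product using (_,_; proj₁; proj₂)
open import Data.Sum using (_⊎_; inj₁; inj₂)
open import Data.Unit using (⊤; tt)
open import Data.Empty using (⊥-elim)
open import Relation.Nullary using (¬_)
open import Relation.Binary.Bundles using (Setoid)
open import Relation.Binary.PropositionalEquality
  using (_≡_; _≢_; refl; sym; trans; cong; cong₂; subst; module ≡-Reasoning)
open import Relation.Binary.PropositionalEquality.Properties using (subst-subst-sym)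
open import Function.Bundles using (mk⇔)
import Relation.Binary.Reasoning.Setoid as SetoidReasoning

module Walks {V E : Set} where

  last : ∀ {n} → Walk V E n → V
  last [ v ] = v
  last (_ ∷⟨ _ ⟩ w) = last w

  firstEdge : ∀ {n} → Walk V E (suc n) → E
  firstEdge (_ ∷⟨ e ⟩ _) = e

  snoc-first : ∀ {n} (w : Walk V E n) e v → first (snoc w e v) ≡ first w
  snoc-first [ u ] e v = refl
  snoc-first (u ∷⟨ f ⟩ w) e v = refl

  snoc-last : ∀ {n} (w : Walk V E n) e v → last (snoc w e v) ≡ v
  snoc-last [ u ] e v = refl
  snoc-last (u ∷⟨ f ⟩ w) e v = snoc-last w e v

  reverse-snoc : ∀ {n} (w : Walk V E n) e v → reverse (snoc w e v) ≡ v ∷⟨ e ⟩ reverse w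
  reverse-snoc [ u ] e v = refl
  reverse-snoc (u ∷⟨ f ⟩ w) e v = cong (λ x → snoc x f u) (reverse-snoc w e v)

  reverse-involutive : ∀ {n} (w : Walk V E n) → reverse (reverse w) ≡ w
  reverse-involutive [ v ] = refl
  reverse-involutive (v ∷⟨ e ⟩ w) = begin
    reverse (snoc (reverse w) e v)  ≡⟨ reverse-snoc (reverse w) e v ⟩
    v ∷⟨ e ⟩ reverse (reverse w)    ≡⟨ cong (v ∷⟨ e ⟩_) (reverse-involutive w) ⟩
    v ∷⟨ e ⟩ w                      ∎
    where open ≡-Reasoning

  last-reverse : ∀ {n} (w : Walk V E n) → last (reverse w) ≡ first w
  last-reverse [ v ] = refl
  last-reverse (v ∷⟨ e ⟩ w) = snoc-last (reverse w) e v

  init-snoc : ∀ {n} (w : Walk V E n) e v → init (snoc w e v) ≡ w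
  init-snoc [ u ] e v = refl
  init-snoc (u ∷⟨ f ⟩ [ x ]) e v = refl
  init-snoc (u ∷⟨ f ⟩ (x ∷⟨ g ⟩ w)) e v = cong (u ∷⟨ f ⟩_) (init-snoc (x ∷⟨ g ⟩ w) e v)

  tail-snoc : ∀ {n} (w : Walk V E (suc n)) e v → tail (snoc w e v) ≡ snoc (tail w) e v
  tail-snoc (u ∷⟨ f ⟩ w) e v = refl

  init-reverse : ∀ {n} (w : Walk V E (suc n)) → init (reverse w) ≡ reverse (tail w)
  init-reverse (v ∷⟨ e ⟩ w) = init-snoc (reverse w) e v

  tail-reverse : ∀ {n} (w : Walk V E (suc n)) → tail (reverse w) ≡ reverse (init w)
  tail-reverse (v ∷⟨ e ⟩ [ u ]) = refl
  tail-reverse (v ∷⟨ e ⟩ w@(u ∷⟨ f ⟩ _)) = begin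
    tail (snoc (reverse w) e v)  ≡⟨ tail-snoc (reverse w) e v ⟩
    snoc (tail (reverse w)) e v  ≡⟨ cong (λ x → snoc x e v) (tail-reverse w) ⟩
    snoc (reverse (init w)) e v  ∎
    where open ≡-Reasoning

  tail-init : ∀ {n} (w : Walk V E (suc (suc n))) → tail (init w) ≡ middle w
  tail-init (v ∷⟨ e ⟩ (u ∷⟨ f ⟩ w)) = refl

  first-init : ∀ {n} (w : Walk V E (suc n)) → first (init w) ≡ first w
  first-init (v ∷⟨ e ⟩ [ u ]) = refl
  first-init (v ∷⟨ e ⟩ (u ∷⟨ f ⟩ w)) = refl

  middle-reverse : ∀ {n} (w : Walk V E (suc (suc n))) → middle (reverse w) ≡ reverse (middle w)
  middle-reverse w = begin
    init (tail (reverse w))    ≡⟨ cong init (tail-reverse w) ⟩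
    init (reverse (init w))    ≡⟨ init-reverse (init w) ⟩
    reverse (tail (init w))    ≡⟨ cong reverse (tail-init w) ⟩
    reverse (middle w)         ∎
    where open ≡-Reasoning

  prefix-irrelevant : ∀ {k n} (p q : k ≤ n) (w : Walk V E n) → prefix p w ≡ prefix q w
  prefix-irrelevant p q w = cong (λ r → prefix r w) (≤-irrelevant p q)

  prefix-full : ∀ {n} (p : n ≤ n) (w : Walk V E n) → prefix p w ≡ w
  prefix-full z≤n [ v ] = refl
  prefix-full (s≤s p) (v ∷⟨ e ⟩ w) = cong (v ∷⟨ e ⟩_) (prefix-full p w)

  prefix-init : ∀ {k n} (p : k ≤ n) (q : suc k ≤ n) (w : Walk V E n) → prefix p w ≡ init (prefix q w)
  prefix-init z≤n (s≤s z≤n) (v ∷⟨ e ⟩ w) = refl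
  prefix-init (s≤s p) (s≤s (s≤s q)) (v ∷⟨ e ⟩ w@(u ∷⟨ f ⟩ _)) =
    cong (v ∷⟨ e ⟩_) (prefix-init p (s≤s q) w)

  first-prefix : ∀ {k n} (p : k ≤ n) (w : Walk V E n) → first (prefix p w) ≡ first w
  first-prefix z≤n w = refl
  first-prefix (s≤s p) (v ∷⟨ e ⟩ w) = refl

  -- Equality up to reversal (definitionally the relation _≈L_ of any graph
  -- on these vertices and edges); it is an equivalence relation.

  _~_ : ∀ {n} → Walk V E n → Walk V E n → Set
  w ~ w' = (w ≡ w') ⊎ (w ≡ reverse w')

  ~-refl : ∀ {n} {w : Walk V E n} → w ~ w
  ~-refl = inj₁ refl

  ~-sym : ∀ {n} {a b : Walk V E n} → a ~ b → b ~ a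
  ~-sym (inj₁ p) = inj₁ (sym p)
  ~-sym {b = b} (inj₂ refl) = inj₂ (sym (reverse-involutive b))

  ~-trans : ∀ {n} {a b c : Walk V E n} → a ~ b → b ~ c → a ~ c
  ~-trans (inj₁ refl) q = q
  ~-trans (inj₂ refl) (inj₁ refl) = inj₂ refl
  ~-trans {c = c} (inj₂ refl) (inj₂ refl) = inj₁ (reverse-involutive c)

  ~-reverse : ∀ {n} (w : Walk V E n) → w ~ reverse w
  ~-reverse w = inj₂ (sym (reverse-involutive w))

  ~-setoid : ℕ → Setoid _ _
  ~-setoid n = record
    { Carrier = Walk V E n
    ; _≈_ = _~_
    ; isEquivalence = record { refl = ~-refl ; sym = ~-sym ; trans = ~-trans }
    }

  middle-resp : ∀ {n} {a b : Walk V E (suc (suc n))} → a ~ b → middle a ~ middle b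
  middle-resp (inj₁ refl) = inj₁ refl
  middle-resp {b = b} (inj₂ refl) = inj₂ (middle-reverse b)

  IsWalkBy-snoc : ∀ (Inc : E → V → V → Set) {n} (w : Walk V E n) e v →
    IsWalkBy Inc w → Inc e (last w) v → IsWalkBy Inc (snoc w e v)
  IsWalkBy-snoc Inc [ u ] e v _ i = i , tt
  IsWalkBy-snoc Inc (u ∷⟨ f ⟩ w) e v (j , iw) i =
    subst (Inc f u) (sym (snoc-first w e v)) j , IsWalkBy-snoc Inc w e v iw i

  IsWalkBy-reverse : ∀ (Inc : E → V → V → Set) → (∀ e a b → Inc e a b → Inc e b a) →
    ∀ {n} (w : Walk V E n) → IsWalkBy Inc w → IsWalkBy Inc (reverse w)
  IsWalkBy-reverse Inc symm [ v ] _ = tt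
  IsWalkBy-reverse Inc symm (v ∷⟨ e ⟩ w) (i , iw) =
    IsWalkBy-snoc Inc (reverse w) e v (IsWalkBy-reverse Inc symm w iw)
      (subst (λ x → Inc e x v) (sym (last-reverse w)) (symm e v (first w) i))

  IsWalkBy-init : ∀ (Inc : E → V → V → Set) {n} (w : Walk V E (suc n)) →
    IsWalkBy Inc w → IsWalkBy Inc (init w)
  IsWalkBy-init Inc (v ∷⟨ e ⟩ [ u ]) c = tt
  IsWalkBy-init Inc (v ∷⟨ e ⟩ w@(u ∷⟨ f ⟩ _)) (i , iw) =
    subst (Inc e v) (sym (first-init w)) i , IsWalkBy-init Inc w iw

  IsWalkBy-prefix : ∀ (Inc : E → V → V → Set) {k n} (p : k ≤ n) (w : Walk V E n) →
    IsWalkBy Inc w → IsWalkBy Inc (prefix p w)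
  IsWalkBy-prefix Inc z≤n w _ = tt
  IsWalkBy-prefix Inc (s≤s p) (v ∷⟨ e ⟩ w) (i , iw) =
    subst (Inc e v) (sym (first-prefix p w)) i , IsWalkBy-prefix Inc p w iw

  -- Conditions on consecutive edges: the same stability properties.
  -- LastEdge D w e says that the last edge of w (if any) is D-related to e,
  -- which is what appending e needs.

  LastEdge : (E → E → Set) → ∀ {n} → Walk V E n → E → Set
  LastEdge D [ _ ] e = ⊤
  LastEdge D (_ ∷⟨ f ⟩ [ _ ]) e = D f e
  LastEdge D (_ ∷⟨ _ ⟩ w@(_ ∷⟨ _ ⟩ _)) e = LastEdge D w e

  LastEdge-snoc : ∀ (D : E → E → Set) {n} (w : Walk V E n) f u e →
    D f e → LastEdge D (snoc w f u) e
  LastEdge-snoc D [ x ] f u e d = d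
  LastEdge-snoc D (x ∷⟨ g ⟩ [ y ]) f u e d = d
  LastEdge-snoc D (x ∷⟨ g ⟩ w@(_ ∷⟨ _ ⟩ _)) f u e d = LastEdge-snoc D w f u e d

  Consec-snoc : ∀ (D : E → E → Set) {n} (w : Walk V E n) e v →
    Consec D w → LastEdge D w e → Consec D (snoc w e v)
  Consec-snoc D [ u ] e v c l = tt
  Consec-snoc D (u ∷⟨ f ⟩ [ x ]) e v c l = l , tt
  Consec-snoc D (u ∷⟨ f ⟩ w@(_ ∷⟨ _ ⟩ _)) e v (d , c) l = d , Consec-snoc D w e v c l

  Consec-reverse : ∀ (D : E → E → Set) → (∀ {a b} → D a b → D b a) →
    ∀ {n} (w : Walk V E n) → Consec D w → Consec D (reverse w)
  Consec-reverse D symm [ v ] c = tt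
  Consec-reverse D symm (v ∷⟨ e ⟩ [ u ]) c = tt
  Consec-reverse D symm (v ∷⟨ e ⟩ w@(u ∷⟨ f ⟩ w')) (d , c) =
    Consec-snoc D (reverse w) e v (Consec-reverse D symm w c)
      (LastEdge-snoc D (reverse w') f u e (symm d))

  Consec-tail : ∀ (D : E → E → Set) {n} (w : Walk V E (suc n)) → Consec D w → Consec D (tail w)
  Consec-tail D (v ∷⟨ e ⟩ [ u ]) c = tt
  Consec-tail D (v ∷⟨ e ⟩ (u ∷⟨ f ⟩ w)) c = proj₂ c

  Consec-init : ∀ (D : E → E → Set) {n} (w : Walk V E (suc n)) → Consec D w → Consec D (init w)
  Consec-init D (v ∷⟨ e ⟩ [ u ]) c = tt
  Consec-init D (v ∷⟨ e ⟩ (u ∷⟨ f ⟩ [ x ])) c = tt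
  Consec-init D (v ∷⟨ e ⟩ w@(u ∷⟨ f ⟩ (x ∷⟨ g ⟩ _))) (d , c) = d , Consec-init D w c

  Consec-prefix : ∀ (D : E → E → Set) {k n} (p : k ≤ n) (w : Walk V E n) →
    Consec D w → Consec D (prefix p w)
  Consec-prefix D z≤n w _ = tt
  Consec-prefix D (s≤s z≤n) (v ∷⟨ e ⟩ w) _ = tt
  Consec-prefix D (s≤s (s≤s p)) (v ∷⟨ e ⟩ w@(u ∷⟨ f ⟩ _)) (d , c) =
    d , Consec-prefix D (s≤s p) w c

Consec-transfer : ∀ {V V' E E' : Set} (RV : V → V' → Set) (RE : E → E' → Set)
  (D : E → E → Set) (D' : E' → E' → Set) →
  (∀ {a b a' b'} → RE a a' → RE b b' → D' a' b' → D a b) →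
  ∀ {n} (L : Walk V E n) (M : Walk V' E' n) → Pointwise RV RE L M → Consec D' M → Consec D L
Consec-transfer RV RE D D' resp [ v ] [ v' ] _ _ = tt
Consec-transfer RV RE D D' resp (v ∷⟨ e ⟩ [ u ]) (v' ∷⟨ e' ⟩ [ u' ]) _ _ = tt
Consec-transfer RV RE D D' resp (v ∷⟨ e ⟩ L@(u ∷⟨ f ⟩ _)) (v' ∷⟨ e' ⟩ M@(u' ∷⟨ f' ⟩ _))
  (_ , re , pw) (d , c) =
  resp re (proj₁ (proj₂ pw)) d , Consec-transfer RV RE D D' resp L M pw c

module LinkGraphs (G : Graph) where
  open Graph G
  open Walks {V} {E}

  Joins-sym : ∀ e a b → Joins e a b → Joins e b a
  Joins-sym e a b (inj₁ p) = inj₂ p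
  Joins-sym e a b (inj₂ p) = inj₁ p

  Joins-irrefl : ∀ {e a b} → Joins e a b → a ≢ b
  Joins-irrefl {e} (inj₁ p) eq = loopless e (trans (cong proj₁ p) (trans eq (sym (cong proj₂ p))))
  Joins-irrefl {e} (inj₂ p) eq = loopless e (trans (cong proj₁ p) (trans (sym eq) (sym (cong proj₂ p))))

  Joins-back : ∀ {e a b c} → Joins e a b → Joins e b c → a ≡ c
  Joins-back j@(inj₁ p) (inj₁ q) = ⊥-elim (Joins-irrefl j (cong proj₁ (trans (sym p) q)))
  Joins-back (inj₁ p) (inj₂ q) = cong proj₁ (trans (sym p) q)
  Joins-back (inj₂ p) (inj₁ q) = cong proj₂ (trans (sym p) q)
  Joins-back j@(inj₂ p) (inj₂ q) = ⊥-elim (Joins-irrefl j (cong proj₂ (trans (sym p) q)))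

  Link : ∀ {n} → Walk V E n → Set
  Link {n} w = IsLink G n w

  Link-reverse : ∀ {n} (w : Walk V E n) → Link w → Link (reverse w)
  Link-reverse w (a , b) =
    IsWalkBy-reverse Joins Joins-sym w a , Consec-reverse _≢_ (λ p q → p (sym q)) w b

  Link-tail : ∀ {n} (w : Walk V E (suc n)) → Link w → Link (tail w)
  Link-tail (v ∷⟨ e ⟩ w) (a , b) = proj₂ a , Consec-tail _≢_ (v ∷⟨ e ⟩ w) b

  Link-init : ∀ {n} (w : Walk V E (suc n)) → Link w → Link (init w)
  Link-init w (a , b) = IsWalkBy-init Joins w a , Consec-init _≢_ w b

  Link-prefix : ∀ {k n} (p : k ≤ n) (w : Walk V E n) → Link w → Link (prefix p w)
  Link-prefix p w (a , b) = IsWalkBy-prefix Joins p w a , Consec-prefix _≢_ p w b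

  Link-middle : ∀ {n} (w : Walk V E (suc (suc n))) → Link w → Link (middle w)
  Link-middle w l = Link-init (tail w) (Link-tail w l)

  Link-subst : ∀ {m n} (p : m ≡ n) (w : Walk V E m) → Link w → Link (subst (Walk V E) p w)
  Link-subst refl w l = l

  -- A link of positive length is not a palindrome: otherwise its middle is
  -- a shorter palindromic link, down to [a, e, a] or [a, e, b, e, a].
  link-not-palindrome : ∀ {n} (w : Walk V E (suc n)) → Link w → w ≢ reverse w
  link-not-palindrome (a ∷⟨ e ⟩ [ b ]) ((j , _) , _) eq = Joins-irrefl j (cong first eq)
  link-not-palindrome (a ∷⟨ e ⟩ (b ∷⟨ f ⟩ [ c ])) (_ , (d , _)) eq = d (cong firstEdge eq)
  link-not-palindrome w@(_ ∷⟨ _ ⟩ (_ ∷⟨ _ ⟩ (_ ∷⟨ _ ⟩ _))) l eq =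
    link-not-palindrome (middle w) (Link-middle w l)
      (trans (cong middle eq) (middle-reverse w))

  -- The two ends of a link of positive length (as ℓ-links) are distinct
  -- vertices of 𝕃ℓ(G): an edge of 𝕃ℓ(G) given by a link is never a loop.
  init≁tail : ∀ {n} (X : Walk V E (suc n)) → Link X → ¬ (init X ~ tail X)
  init≁tail X@(_ ∷⟨ _ ⟩ _) ((j , _) , _) (inj₁ eq) =
    Joins-irrefl j (trans (sym (first-init X)) (cong first eq))
  init≁tail (a ∷⟨ e ⟩ [ b ]) ((j , _) , _) (inj₂ eq) = Joins-irrefl j (cong first eq)
  init≁tail (a ∷⟨ e ⟩ (b ∷⟨ f ⟩ [ c ])) (_ , (d , _)) (inj₂ eq) = d (cong firstEdge eq)
  init≁tail X@(_ ∷⟨ _ ⟩ (_ ∷⟨ _ ⟩ (_ ∷⟨ _ ⟩ _))) l (inj₂ eq) =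
    link-not-palindrome (middle X) (Link-middle X l) (begin
      middle X                    ≡⟨ tail-init X ⟨
      tail (init X)               ≡⟨ cong tail eq ⟩
      tail (reverse (tail X))     ≡⟨ tail-reverse (tail X) ⟩
      reverse (middle X)          ∎)
    where open ≡-Reasoning

  SamePart-sym : ∀ ℓ {a b : Walk V E (suc ℓ)} → SamePart G ℓ a b → SamePart G ℓ b a
  SamePart-sym zero p = ~-sym p
  SamePart-sym (suc ℓ) p = ~-sym p

  SamePart-resp : ∀ ℓ {a b a' b' : Walk V E (suc ℓ)} →
    a ~ a' → b ~ b' → SamePart G ℓ a b → SamePart G ℓ a' b'
  SamePart-resp zero p q sp = ~-trans (~-sym p) (~-trans sp q)
  SamePart-resp (suc ℓ) p q sp = ~-trans (~-sym (middle-resp p)) (~-trans sp (middle-resp q))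

  DifferentParts : ∀ ℓ → Walk V E (suc ℓ) → Walk V E (suc ℓ) → Set
  DifferentParts ℓ Q Q' = ¬ SamePart G ℓ Q Q'

  window-one : ∀ ℓ (Q : Walk V E (suc ℓ)) → window G ℓ 1 Q ≡ init Q ∷⟨ Q ⟩ [ tail Q ]
  window-one ℓ Q = cong₂ (λ A Q' → A ∷⟨ Q' ⟩ [ tail Q ])
    (trans (prefix-init _ ≤-full Q) (cong init (prefix-full ≤-full Q)))
    (prefix-full _ Q)
    where
    ≤-full : suc ℓ ≤ suc ℓ
    ≤-full = ≤-refl

  window-cons : ∀ ℓ s x e (R' : Walk V E (suc s + ℓ)) (p : ℓ ≤ suc s + ℓ) →
    window G ℓ (suc (suc s)) (x ∷⟨ e ⟩ R')
      ≡ init (x ∷⟨ e ⟩ prefix p R') ∷⟨ x ∷⟨ e ⟩ prefix p R' ⟩ window G ℓ (suc s) R'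
  window-cons ℓ s x e R' p = cong₂ (λ A Q → A ∷⟨ Q ⟩ window G ℓ (suc s) R')
    (prefix-init _ (s≤s p) (x ∷⟨ e ⟩ R'))
    (cong (x ∷⟨ e ⟩_) (prefix-irrelevant _ p R'))

  -- For ℓ = 0, Q₁ ~ Q₂ would make e₁ a loop or
  -- e₁ = e₂; otherwise their middles are init and tail of [v₁ … v_{ℓ+1}].
  windows-differ : ∀ ℓ {n} v₀ e₁ v₁ e₂ (R : Walk V E n) (q : ℓ ≤ suc n) (q' : ℓ ≤ n) →
    Link (v₀ ∷⟨ e₁ ⟩ (v₁ ∷⟨ e₂ ⟩ R)) →
    DifferentParts ℓ (v₀ ∷⟨ e₁ ⟩ prefix q (v₁ ∷⟨ e₂ ⟩ R)) (v₁ ∷⟨ e₂ ⟩ prefix q' R)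
  windows-differ zero v₀ e₁ v₁ e₂ R z≤n z≤n ((j , _) , _) (inj₁ eq) = Joins-irrefl j (cong first eq)
  windows-differ zero v₀ e₁ v₁ e₂ R z≤n z≤n (_ , (d , _)) (inj₂ eq) = d (cong firstEdge eq)
  windows-differ (suc m) v₀ e₁ v₁ e₂ R (s≤s r) q' lk sp =
    init≁tail (v₁ ∷⟨ e₂ ⟩ prefix r R) (Link-prefix (s≤s r) (v₁ ∷⟨ e₂ ⟩ R) (Link-tail _ lk))
      (~-trans sp (inj₁ (sym (prefix-init r q' R))))

  window-parts : ∀ ℓ s (R : Walk V E (s + ℓ)) → Link R → Consec (DifferentParts ℓ) (window G ℓ s R)
  window-parts ℓ zero R lk = tt
  window-parts ℓ (suc zero) R lk = tt
  window-parts ℓ (suc (suc s)) (v₀ ∷⟨ e₁ ⟩ R@(v₁ ∷⟨ e₂ ⟩ R')) lk =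
    windows-differ ℓ v₀ e₁ v₁ e₂ R' _ _ lk , window-parts ℓ (suc s) R (Link-tail _ lk)

  DifferentParts-resp : ∀ ℓ {a b a' b' : Walk V E (suc ℓ)} →
    a ~ a' → b ~ b' → DifferentParts ℓ a' b' → DifferentParts ℓ a b
  DifferentParts-resp ℓ p q diff sp = diff (SamePart-resp ℓ p q sp)

  DifferentParts-sym : ∀ ℓ {a b : Walk V E (suc ℓ)} → DifferentParts ℓ a b → DifferentParts ℓ b a
  DifferentParts-sym ℓ diff sp = diff (SamePart-sym ℓ sp)

  backward : ∀ ℓ s (L : LWalk G ℓ s) (R : Walk V E (s + ℓ)) → Link R →
    _≈LL_ G L (window G ℓ s R) → Consec (DifferentParts ℓ) L
  backward ℓ s L R lk (inj₁ pw) =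
    Consec-transfer _~_ _~_ _ _ (DifferentParts-resp ℓ) L (window G ℓ s R) pw (window-parts ℓ s R lk)
  backward ℓ s L R lk (inj₂ pw) =
    Consec-transfer _~_ _~_ _ _ (DifferentParts-resp ℓ) L (reverse (window G ℓ s R)) pw
      (Walks.Consec-reverse _ (DifferentParts-sym ℓ) (window G ℓ s R) (window-parts ℓ s R lk))

  orient : ∀ {ℓ} {Q : Walk V E (suc ℓ)} {A B : Walk V E ℓ} → Link Q → LJoins G Q A B →
    Σ (Walk V E (suc ℓ)) λ Q' → Link Q' × Q ~ Q' × A ~ init Q' × B ~ tail Q'
  orient {Q = Q} lq (inj₁ (a , b)) = Q , lq , ~-refl , ~-sym a , ~-sym b
  orient {Q = Q} lq (inj₂ (a , b)) =
    reverse Q , Link-reverse Q lq , ~-reverse Q ,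
    ~-trans (~-sym b) (~-trans (~-reverse (tail Q)) (inj₁ (sym (init-reverse Q)))) ,
    ~-trans (~-sym a) (~-trans (~-reverse (init Q)) (inj₁ (sym (tail-reverse Q))))

  -- If Q = [x, e, T] is followed by Q₂ in a different part, and T is the
  -- first ℓ-window P of R' up to reversal, then T = P exactly: were
  -- T = reverse P, the middle of Q would be the reversed tail of P, which is
  -- the middle of the first (ℓ+1)-window of R', i.e. of Q₂.
  forced-orientation : ∀ ℓ {n} {x e} (T : Walk V E ℓ) (R' : Walk V E (suc n)) (Q Q₂ : Walk V E (suc ℓ))
    (p : ℓ ≤ suc n) (q : suc ℓ ≤ suc n) → DifferentParts ℓ Q Q₂ → Q ~ (x ∷⟨ e ⟩ T) →
    Q₂ ~ prefix q R' → T ~ prefix p R' → T ≡ prefix p R'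
  forced-orientation ℓ T R' Q Q₂ p q diff qq q₂q (inj₁ eq) = eq
  forced-orientation zero T R' Q Q₂ z≤n q diff qq q₂q (inj₂ eq) = eq
  forced-orientation (suc m) T (u ∷⟨ f ⟩ R'') Q Q₂ (s≤s p) (s≤s q) diff qq q₂q (inj₂ refl) =
    ⊥-elim (diff (begin
      middle Q                                 ≈⟨ middle-resp qq ⟩
      init (reverse (u ∷⟨ f ⟩ prefix p R''))   ≡⟨ init-reverse (u ∷⟨ f ⟩ prefix p R'') ⟩
      reverse (prefix p R'')                   ≈⟨ ~-reverse (prefix p R'') ⟨
      prefix p R''                             ≡⟨ prefix-init p q R'' ⟩
      middle (prefix (s≤s q) (u ∷⟨ f ⟩ R''))   ≈⟨ middle-resp q₂q ⟨
      middle Q₂                                ∎))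
    where open SetoidReasoning (~-setoid m)

  -- For ℓ ≥ 1 this is read off Q itself; for ℓ = 0 a
  -- backtrack e = f would make Q the reverse of the next edge Q₂ of 𝕃₀(G).
  extend-link : ∀ ℓ {n} x e (R' : Walk V E (suc n)) (p : ℓ ≤ suc n) (q : suc ℓ ≤ suc n)
    (Q Q₂ : Walk V E (suc ℓ)) → ¬ (Q ~ Q₂) → Q ~ (x ∷⟨ e ⟩ prefix p R') → Q₂ ~ prefix q R' →
    Link (x ∷⟨ e ⟩ prefix p R') → Link R' → Link (x ∷⟨ e ⟩ R')
  extend-link (suc m) x e R'@(_ ∷⟨ _ ⟩ _) (s≤s p) q Q Q₂ nq qq q₂q ((j , _) , d , _) (wR , cR) =
    (subst (Joins e x) (first-prefix (s≤s p) R') j , wR) , d , cR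
  extend-link zero x e R'@(u ∷⟨ f ⟩ _) z≤n (s≤s z≤n) Q Q₂ nq qq q₂q ((j , _) , _) lR@((j' , _) , _) =
    (j , proj₁ lR) , e≢f , proj₂ lR
    where
    e≢f : e ≢ f
    e≢f refl = nq (~-trans qq (~-trans (inj₂ (cong (λ z → z ∷⟨ e ⟩ [ u ]) (Joins-back j j'))) (~-sym q₂q)))

  forward : ∀ ℓ s (L : LWalk G ℓ s) → IsLinkLTilde G ℓ s L →
    Σ (Walk V E (s + ℓ)) λ R → Link R × Pointwise _~_ _~_ L (window G ℓ s R)
  forward ℓ zero [ A ] ((lA , _) , _) = A , lA , ~-refl
  forward ℓ (suc zero) (A ∷⟨ Q ⟩ [ B ]) ((_ , (lQ , _) , (jQ , _) , _) , _)
    with orient lQ jQ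
  ... | Q' , lQ' , qq , aq , bq =
    Q' , lQ' , subst (Pointwise _~_ _~_ (A ∷⟨ Q ⟩ [ B ])) (sym (window-one ℓ Q')) (aq , qq , bq)
  forward ℓ (suc (suc s)) (A ∷⟨ Q ⟩ L'@(B ∷⟨ Q₂ ⟩ _))
      (((_ , lL'ᵥ) , (lQ , lL'ₑ) , (jQ , wL') , (nq , cL')) , (diff , pL'))
    with forward ℓ (suc s) L' ((lL'ᵥ , lL'ₑ , wL' , cL') , pL') | orient lQ jQ
  ... | R' , lR' , pw@(bp , q₂q , _) | (x ∷⟨ e ⟩ T) , lQ' , qq , aq , bq
    with forced-orientation ℓ T R' Q Q₂ _ _ diff qq q₂q (~-trans (~-sym bq) bp)
  ... | refl =
    x ∷⟨ e ⟩ R' , extend-link ℓ x e R' _ _ Q Q₂ nq qq q₂q lQ' lR' ,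
    subst (Pointwise _~_ _~_ (A ∷⟨ Q ⟩ L')) (sym (window-cons ℓ s x e R' _)) (aq , qq , pw)

lemma5p2 : (ℓ s : ℕ) (G : Graph) (L : LWalk G ℓ s) → IsLinkL G ℓ s L →
    (IsLinkLTilde G ℓ s L ⇔
    Σ (Walk (Graph.V G) (Graph.E G) (ℓ + s)) (λ R → IsLink G (ℓ + s) R × _≈LL_ G L (linkL G ℓ s R)))
lemma5p2 ℓ s G L isL = mk⇔ to from
  where
  open Graph G
  open LinkGraphs G
  ℓ+s≡s+ℓ : ℓ + s ≡ s + ℓ
  ℓ+s≡s+ℓ = +-comm ℓ s
  to : IsLinkLTilde G ℓ s L →
       Σ (Walk V E (ℓ + s)) (λ R → IsLink G (ℓ + s) R × _≈LL_ G L (linkL G ℓ s R))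
  to tilde with forward ℓ s L tilde
  ... | R , lR , pw =
    subst (Walk V E) (sym ℓ+s≡s+ℓ) R , Link-subst (sym ℓ+s≡s+ℓ) R lR ,
    inj₁ (subst (λ X → Pointwise _ _ L (window G ℓ s X)) (sym (subst-subst-sym ℓ+s≡s+ℓ)) pw)
  from : Σ (Walk V E (ℓ + s)) (λ R → IsLink G (ℓ + s) R × _≈LL_ G L (linkL G ℓ s R)) →
         IsLinkLTilde G ℓ s L
  from (R , lR , L≈R) = isL , backward ℓ s L (subst (Walk V E) ℓ+s≡s+ℓ R) (Link-subst ℓ+s≡s+ℓ R lR) L≈R
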